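{- Let $n\ge1$, let $\mathcal{K}$ be a regular incidence complex of rank $n$, let $\Gamma$ be a flag-transitive subgroup of $\Gamma(\mathcal{K})$, let $\Phi=\{F_{ -1},F_0,\dots,F_n\}$ be a flag of $\mathcal{K}$ ($F_i$ of rank $i$), and let $R_i=\{\varphi\in\Gamma: F_j\varphi=F_j\text{ for all }j\ne i\}$ for $i=-1,\dots,n$. Then $\mathcal{K}$ is isomorphic to the complex $\mathcal{K}(\Gamma;R_{ -1},R_0,\dots,R_n)$; in particular, the map $F_i\varphi\mapsto\Gamma_i\varphi$ ($-1\le i\le n$, $\varphi\in\Gamma$) is a well-defined isomorphism.
   Context: An incidence complex of rank $n$ is a poset with: (I1) a least face and a greatest face; (I2) every chain contained in a maximal chain (flag) with exactly $n+2$ elements (so there is a rank function with values $-1,\dots,n$); (I3) every section $G/F=\{H:F\le H\le G\}$ (including the poset) connected, where rank $\le1$ posets are connected and a rank $\ge2$ poset is connected if any two proper faces are joined by a finite sequence of proper faces with consecutive members comparable; (I4) for $i=0,\dots,n-1$, whenever $F<G$ with ranks $i-1,i+1$, at least two $i$-faces strictly between them. $\Gamma(\mathcal{K})$ is its automorphism group (order-preserving bijections with order-preserving inverse), acting on the right ($F\varphi$ = image of $F$); $\mathcal{K}$ is regular if $\Gamma(\mathcal{K})$ is flag-transitive; $\Gamma\le\Gamma(\mathcal{K})$ is flag-transitive if transitive on flags. Let $N=\{ -1,\dots,n\}$; $\Gamma_I=\langle R_i:i\in I\rangle$ for nonempty $I\subseteq N$, $\Gamma_\emptyset=R_{ -1}$,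 $\Gamma_i=\Gamma_{N\setminus\{i\}}$ (so $\Gamma_{ -1}=\Gamma_n=\Gamma$), $\Gamma_i^-=\Gamma_{\{ -1,\dots,i\}}$, $\Gamma_i^+=\Gamma_{\{i,\dots,n\}}$. The poset $\mathcal{K}(\Gamma;R_{ -1},\dots,R_n)$ has as $i$-faces ($0\le i\le n-1$) the right cosets $\Gamma_i\varphi$, $\varphi\in\Gamma$, plus two distinct improper faces $\Gamma_{ -1}$ (rank $-1$) and $\Gamma_n$ (rank $n$), each a copy of $\Gamma$, with $\Gamma_{ -1}\varphi=\Gamma_{ -1}$ and $\Gamma_n\varphi=\Gamma_n$; the order is $\Gamma_i\varphi\le\Gamma_j\psi$ iff $i\le j$ and $\varphi\psi^{ -1}\in\Gamma_{i+1}^+\Gamma_{j-1}^-$. -}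

module Defs where

open import Data.Nat using (ℕ; zero; suc; _≤?_) renaming (_≤_ to _≤ℕ_; _<_ to _<ℕ_)
open import Data.Fin using (Fin; toℕ; _≟_)
open import Data.Fin.Properties using (any?)
open import Data.Product using (Σ; ∃; _×_; _,_; proj₁; proj₂)
open import Data.Sum using (_⊎_)
open import Data.List using (List)
open import Relation.Nullary using (¬_; Dec; yes; no)
open import Relation.Nullary.Decidable using (¬?)
open import Data.Unit using (⊤)
open import Relation.Binary.PropositionalEquality using (_≡_; _≢_)
open import Relation.Binary.Structures using (IsPartialOrder)
open import Function.Bundles using (_⇔_)

record Poset : Set₁ where
  field
    Face : Set
    _≤_  : Face → Face → Set
    isPartialOrder : IsPartialOrder _≡_ _≤_

module PosetNotions (P : Poset) where
  open Poset P public

  _<_ : Face → Face → Set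
  F < G = F ≤ G × F ≢ G

  Comparable : Face → Face → Set
  Comparable F G = F ≤ G ⊎ G ≤ F

  IsChain : (Face → Set) → Set
  IsChain C = ∀ F G → C F → C G → Comparable F G

  _⊆_ : (Face → Set) → (Face → Set) → Set
  C ⊆ D = ∀ F → C F → D F

  IsMaximalChain : (Face → Set) → Set₁
  IsMaximalChain M = IsChain M × (∀ D → IsChain D → M ⊆ D → D ⊆ M)

  HasExactly : ℕ → (Face → Set) → Set
  HasExactly m C = Σ (Fin m → Face) λ e →
    (∀ k l → e k ≡ e l → k ≡ l) × (∀ F → C F ⇔ (∃ λ k → e k ≡ F))

  -- A flag of a rank-n complex, enumerated increasingly:
  -- position k : Fin (n+2) holds the face of rank (toℕ k − 1).
  record Flag (n : ℕ) : Set₁ where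
    field
      face : Fin (suc (suc n)) → Face
      increasing : ∀ k l → toℕ k <ℕ toℕ l → face k < face l
      maximal : IsMaximalChain (λ F → ∃ λ k → face k ≡ F)
  open Flag public

  -- F has rank (toℕ k − 1): it sits at position k of some flag
  HasRankPos : (n : ℕ) → Face → Fin (suc (suc n)) → Set₁
  HasRankPos n F k = Σ (Flag n) λ Φ → face Φ k ≡ F

  Proper : Face → Face → Face → Set
  Proper F G H = F < H × H < G

  data Joined (F G : Face) (H : Face) : Face → Set where
    here : Joined F G H H
    step : ∀ {H′ H″} → Joined F G H H′ → Proper F G H″ →
           Comparable H′ H″ → Joined F G H H″

  record Aut : Set where
    field
      fun : Face → Face
      inv : Face → Face
      inv-fun : ∀ F → inv (fun F) ≡ F
      fun-inv : ∀ F → fun (inv F) ≡ F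
      fun-mono : ∀ {F G} → F ≤ G → fun F ≤ fun G
      inv-mono : ∀ {F G} → F ≤ G → inv F ≤ inv G
  open Aut public

  -- right action: F (φ · ψ) = (F φ) ψ
  _·_ : Aut → Aut → Aut
  φ · ψ = record
    { fun = λ F → fun ψ (fun φ F)
    ; inv = λ F → inv φ (inv ψ F)
    ; inv-fun = λ F → Relation.Binary.PropositionalEquality.trans
        (Relation.Binary.PropositionalEquality.cong (inv φ) (inv-fun ψ (fun φ F))) (inv-fun φ F)
    ; fun-inv = λ F → Relation.Binary.PropositionalEquality.trans
        (Relation.Binary.PropositionalEquality.cong (fun ψ) (fun-inv φ (inv ψ F))) (fun-inv ψ F)
    ; fun-mono = λ p → fun-mono ψ (fun-mono φ p)
    ; inv-mono = λ p → inv-mono φ (inv-mono ψ p)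
    }

  _⁻¹ : Aut → Aut
  φ ⁻¹ = record
    { fun = inv φ ; inv = fun φ ; inv-fun = fun-inv φ ; fun-inv = inv-fun φ
    ; fun-mono = inv-mono φ ; inv-mono = fun-mono φ }

  idAut : Aut
  idAut = record
    { fun = λ F → F ; inv = λ F → F
    ; inv-fun = λ _ → Relation.Binary.PropositionalEquality.refl
    ; fun-inv = λ _ → Relation.Binary.PropositionalEquality.refl
    ; fun-mono = λ p → p ; inv-mono = λ p → p }

  _≐_ : Aut → Aut → Set
  φ ≐ ψ = ∀ F → fun φ F ≡ fun ψ F

  record IsSubgroup (S : Aut → Set) : Set where
    field
      resp : ∀ {φ ψ} → φ ≐ ψ → S φ → S ψ
      one  : S idAut
      mul  : ∀ {φ ψ} → S φ → S ψ → S (φ · ψ)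
      inverse : ∀ {φ} → S φ → S (φ ⁻¹)

  data Gen (X : Aut → Set) : Aut → Set where
    base : ∀ {φ} → X φ → Gen X φ
    one  : Gen X idAut
    mul  : ∀ {φ ψ} → Gen X φ → Gen X ψ → Gen X (φ · ψ)
    inverse : ∀ {φ} → Gen X φ → Gen X (φ ⁻¹)
    resp : ∀ {φ ψ} → φ ≐ ψ → Gen X φ → Gen X ψ

  FlagTransitive : (n : ℕ) → (Aut → Set) → Set₁
  FlagTransitive n S = ∀ (Φ Ψ : Flag n) →
    Σ Aut λ φ → S φ × (∀ k → fun φ (face Φ k) ≡ face Ψ k)

record IsIncidenceComplex (n : ℕ) (P : Poset) : Set₁ where
  open PosetNotions P
  field
    least : Face
    least-≤ : ∀ F → least ≤ F
    greatest : Face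
    ≤-greatest : ∀ F → F ≤ greatest
    chains-in-flags : ∀ C → IsChain C →
      Σ (Face → Set) λ M → IsMaximalChain M × C ⊆ M × HasExactly (suc (suc n)) M
    -- (I3) sections of rank ≥ 2 (rank(G) − rank(F) − 1 ≥ 2) are connected
    connected : ∀ F G a b → HasRankPos n F a → HasRankPos n G b → F ≤ G →
      suc (suc (suc (toℕ a))) ≤ℕ toℕ b →
      ∀ H H′ → Proper F G H → Proper F G H′ → Joined F G H H′
    -- (I4) diamond-type condition, i = toℕ a, F of rank i−1, G of rank i+1
    diamond : ∀ F G a b → HasRankPos n F a → HasRankPos n G b →
      toℕ b ≡ suc (suc (toℕ a)) → F < G →
      Σ Face λ H → Σ Face λ H′ → Σ (Fin (suc (suc n))) λ c →
        toℕ c ≡ suc (toℕ a) × HasRankPos n H c × HasRankPos n H′ c ×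
        H ≢ H′ × F < H × H < G × F < H′ × H′ < G

record IncidenceComplex (n : ℕ) : Set₁ where
  field
    poset : Poset
    isIncidenceComplex : IsIncidenceComplex n poset
  open PosetNotions poset public

Regular : ∀ {n} → IncidenceComplex n → Set₁
Regular {n} K = FlagTransitive n (λ _ → ⊤)
  where open IncidenceComplex K

module CosetComplex {n : ℕ} (K : IncidenceComplex n)
  (S : IncidenceComplex.Aut K → Set) (Φ : IncidenceComplex.Flag K n)
  where
  open IncidenceComplex K

  Pos : Set
  Pos = Fin (suc (suc n))

  R : Pos → Aut → Set
  R k φ = S φ × (∀ j → j ≢ k → fun φ (face Φ j) ≡ face Φ j)

  -- Γ_I = ⟨R_i : i ∈ I⟩ for nonempty I, and Γ_∅ = R₋₁
  ΓI′ : (I : Pos → Set) → Dec (∃ I) → Aut → Set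
  ΓI′ I (yes _) = Gen (λ φ → ∃ λ k → I k × R k φ)
  ΓI′ I (no _)  = R Data.Fin.zero

  Γexcept : Pos → Aut → Set
  Γexcept p = ΓI′ (λ k → k ≢ p) (any? (λ k → ¬? (k ≟ p)))

  -- Γ^+ over positions ≥ m   (Γ_{i}^+ with i = m − 1)
  Γplus : ℕ → Aut → Set
  Γplus m = ΓI′ (λ k → m ≤ℕ toℕ k) (any? (λ k → m ≤? toℕ k))

  -- Γ^- over positions < q   (Γ_{j}^- with j = q − 2)
  Γminus : ℕ → Aut → Set
  Γminus q = ΓI′ (λ k → toℕ k <ℕ q) (any? (λ k → suc (toℕ k) ≤? q))

  -- faces: (position p, φ ∈ Γ) standing for Γ_p φ
  CFace : Set
  CFace = Pos × Σ Aut S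

  Improper : Pos → Set
  Improper p = toℕ p ≡ 0 ⊎ toℕ p ≡ suc n

  -- equality of faces: Γ_{-1}φ = Γ_{-1}, Γ_nφ = Γ_n; otherwise Γ_iφ = Γ_iψ iff φψ⁻¹ ∈ Γ_i
  _≈c_ : CFace → CFace → Set
  (p , φ , _) ≈c (q , ψ , _) = p ≡ q × (Improper p ⊎ Γexcept p (φ · (ψ ⁻¹)))

  -- Γ_iφ ≤ Γ_jψ iff i ≤ j and φψ⁻¹ ∈ Γ_{i+1}^+ Γ_{j-1}^-
  _≤c_ : CFace → CFace → Set
  (p , φ , _) ≤c (q , ψ , _) = toℕ p ≤ℕ toℕ q ×
    (Σ Aut λ α → Σ Aut λ β → Γplus (suc (toℕ p)) α × Γminus (toℕ q) β ×
      (φ · (ψ ⁻¹)) ≐ (α · β))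

  _↦_ : Face → CFace → Set
  F ↦ (p , φ , _) = fun φ (face Φ p) ≡ F

  record IsWellDefinedIsomorphism : Set where
    field
      well-defined : ∀ {F c d} → F ↦ c → F ↦ d → c ≈c d
      total        : ∀ F → Σ CFace λ c → F ↦ c
      injective    : ∀ {F G c d} → F ↦ c → G ↦ d → c ≈c d → F ≡ G
      surjective   : ∀ c → Σ Face λ F → F ↦ c
      order        : ∀ {F G c d} → F ↦ c → G ↦ d → (F ≤ G ⇔ c ≤c d)

-- The map F_p φ ↦ Γ_p φ is an isomorphism because the subgroups used to
-- build the coset complex are stabilisers:
--   Γ_p           is the stabiliser of F_p,
--   Γ^+ above p   is the pointwise stabiliser of F_0, …, F_p,
--   Γ^- below q   is the pointwise stabiliser of F_q, …, F_{n+1}.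
-- One inclusion is immediate (each generator R_k fixes every face of Φ off
-- position k).  The other is the geometric heart of the proof: if φ fixes Φ off
-- a set L of positions, then Φ and Φφ are joined by a sequence of flags, each
-- differing from the previous one at a single position of L ("strong flag
-- connectivity", a consequence of (I2) and (I3)), and flag-transitivity turns
-- each such step into an element of some R_k with k ∈ L.

module Submission where

open import Defs
open import Data.Nat using (ℕ; _≤_)

open import Data.Nat using (zero; suc; _+_; z≤n; s≤s; s≤s⁻¹; s<s⁻¹; _≤?_; _<?_) renaming (_<_ to _<ℕ_)
import Data.Nat.Properties as NP
open import Data.Fin using (Fin; zero; suc; toℕ; fromℕ<; fromℕ; punchIn; punchOut; inject₁; _≟_)
import Data.Fin as F
import Data.Fin.Properties as FP
import Data.Fin.Induction as FI
open import Data.Fin.Properties using (any?)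
open import Data.Product using (Σ; ∃; _×_; _,_; proj₁; proj₂)
open import Data.Sum using (_⊎_; inj₁; inj₂; swap)
open import Data.Empty using (⊥-elim)
open import Relation.Nullary using (¬_; Dec; yes; no)
open import Relation.Nullary.Decidable using (¬?)
open import Relation.Binary.PropositionalEquality
  using (_≡_; _≢_; _≗_; refl; sym; trans; cong; subst; subst₂)
open import Relation.Binary.Structures using (IsPartialOrder)
open import Function.Bundles using (_⇔_; mk⇔; Equivalence)

module FlagGeometry (n : ℕ) (K : IncidenceComplex n) where
  open IncidenceComplex K renaming (_≤_ to _⊑_; _<_ to _⊏_)
  open IsIncidenceComplex isIncidenceComplex
  open IsPartialOrder isPartialOrder using ()
    renaming (refl to ⊑-refl; reflexive to ⊑-reflexive; trans to ⊑-trans; antisym to ⊑-antisym)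

  Pos : Set
  Pos = Fin (suc (suc n))

  top : Pos
  top = fromℕ (suc n)

  ⊑-⊏-trans : ∀ {x y z} → x ⊑ y → y ⊏ z → x ⊏ z
  ⊑-⊏-trans {y = y} x⊑y (y⊑z , y≢z) =
    ⊑-trans x⊑y y⊑z , λ x≡z → y≢z (⊑-antisym y⊑z (subst (_⊑ y) x≡z x⊑y))

  aut-⊏ : ∀ φ {x y} → x ⊏ y → fun φ x ⊏ fun φ y
  aut-⊏ φ (x⊑y , x≢y) = fun-mono φ x⊑y ,
    λ e → x≢y (trans (sym (inv-fun φ _)) (trans (cong (inv φ) e) (inv-fun φ _)))

  -- Moving an automorphism ψ to the other side of an incidence or equality;
  -- these translate between "Fφ ≤ Gψ" and "F(φψ⁻¹) ≤ G".
  inv-shift-≡ : ∀ ψ {x y} → x ≡ fun ψ y → inv ψ x ≡ y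
  inv-shift-≡ ψ refl = inv-fun ψ _

  inv-unshift-≡ : ∀ ψ {x y} → inv ψ x ≡ y → x ≡ fun ψ y
  inv-unshift-≡ ψ refl = sym (fun-inv ψ _)

  inv-shift-⊑ : ∀ ψ {x y} → x ⊑ fun ψ y → inv ψ x ⊑ y
  inv-shift-⊑ ψ le = subst (_ ⊑_) (inv-fun ψ _) (inv-mono ψ le)

  inv-unshift-⊑ : ∀ ψ {x y} → inv ψ x ⊑ y → x ⊑ fun ψ y
  inv-unshift-⊑ ψ le = subst (_⊑ _) (fun-inv ψ _) (fun-mono ψ le)

  Increasing : ∀ {m} → (Fin m → Face) → Set
  Increasing f = ∀ k l → toℕ k <ℕ toℕ l → f k ⊏ f l

  module _ {m} {f : Fin m → Face} (inc : Increasing f) where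
    increasing-mono : ∀ {k l} → toℕ k ≤ toℕ l → f k ⊑ f l
    increasing-mono {k} {l} k≤l with NP.m≤n⇒m<n∨m≡n k≤l
    ... | inj₁ k<l = proj₁ (inc k l k<l)
    ... | inj₂ k≡l = ⊑-reflexive (cong f (FP.toℕ-injective k≡l))

    increasing-comparable : ∀ k l → Comparable (f k) (f l)
    increasing-comparable k l with NP.≤-total (toℕ k) (toℕ l)
    ... | inj₁ k≤l = inj₁ (increasing-mono k≤l)
    ... | inj₂ l≤k = inj₂ (increasing-mono l≤k)

    index-< : ∀ {k l} → f k ⊏ f l → toℕ k <ℕ toℕ l
    index-< {k} {l} (fk⊑fl , fk≢fl) with toℕ l ≤? toℕ k
    ... | yes l≤k = ⊥-elim (fk≢fl (⊑-antisym fk⊑fl (increasing-mono l≤k)))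
    ... | no l≰k = NP.≰⇒> l≰k

    index-≤ : ∀ {k l} → f k ⊑ f l → toℕ k ≤ toℕ l
    index-≤ {k} {l} fk⊑fl with toℕ l <? toℕ k
    ... | yes l<k = ⊥-elim (proj₂ (inc l k l<k) (⊑-antisym (proj₁ (inc l k l<k)) fk⊑fl))
    ... | no l≮k = NP.≮⇒≥ l≮k

  -- Any strictly increasing enumeration of n+2 faces is a flag: by (I2) a chain
  -- containing it and one more face would lie in a flag with only n+2 faces,
  -- which the pigeonhole principle forbids.
  flagOf : (f : Pos → Face) → Increasing f → Flag n
  flagOf f inc = record { face = f ; increasing = inc ; maximal = chain , maximality }
    where
    Image : Face → Set
    Image x = ∃ λ k → f k ≡ x

    chain : IsChain Image
    chain _ _ (k , refl) (l , refl) = increasing-comparable inc k l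

    maximality : ∀ D → IsChain D → Image ⊆ D → D ⊆ Image
    maximality D chainD Image⊆D x x∈D = conclude (FP.pigeonhole (NP.n<1+n _) index)
      where
      M = chains-in-flags D chainD
      D⊆M = proj₁ (proj₂ (proj₂ M))
      enum = proj₁ (proj₂ (proj₂ (proj₂ M)))
      enum-onto = proj₂ (proj₂ (proj₂ (proj₂ (proj₂ M))))
      indexOf : ∀ y → D y → Pos
      indexOf y y∈D = proj₁ (Equivalence.to (enum-onto y) (D⊆M y y∈D))
      indexOf-correct : ∀ y y∈D → enum (indexOf y y∈D) ≡ y
      indexOf-correct y y∈D = proj₂ (Equivalence.to (enum-onto y) (D⊆M y y∈D))
      index : Fin (suc (suc (suc n))) → Pos
      index zero = indexOf x x∈D
      index (suc k) = indexOf (f k) (Image⊆D (f k) (k , refl))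
      conclude : (∃ λ i → ∃ λ j → i F.< j × index i ≡ index j) → Image x
      conclude (zero , suc l , _ , eq) =
        l , trans (sym (indexOf-correct _ _)) (trans (cong enum (sym eq)) (indexOf-correct x x∈D))
      conclude (suc k , suc l , k<l , eq) = ⊥-elim (proj₂ (inc k l (s<s⁻¹ k<l))
        (trans (sym (indexOf-correct _ _)) (trans (cong enum eq) (indexOf-correct _ _))))

  mapFlag : Aut → Flag n → Flag n
  mapFlag φ Θ = flagOf (λ j → fun φ (face Θ j)) (λ k l k<l → aut-⊏ φ (increasing Θ k l k<l))

  comparable-in-flag : (Θ : Flag n) → ∀ x → (∀ k → Comparable (face Θ k) x) → ∃ λ k → face Θ k ≡ x
  comparable-in-flag Θ x cmp = proj₂ (maximal Θ) D chainD (λ _ → inj₁) x (inj₂ refl)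
    where
    D : Face → Set
    D y = (∃ λ k → face Θ k ≡ y) ⊎ y ≡ x
    chainD : IsChain D
    chainD _ _ (inj₁ (k , refl)) (inj₁ (l , refl)) = increasing-comparable (increasing Θ) k l
    chainD _ _ (inj₁ (k , refl)) (inj₂ refl) = cmp k
    chainD _ _ (inj₂ refl) (inj₁ (k , refl)) = swap (cmp k)
    chainD _ _ (inj₂ refl) (inj₂ refl) = inj₁ ⊑-refl

  flag-bottom : ∀ (Θ : Flag n) → face Θ zero ≡ least
  flag-bottom Θ with comparable-in-flag Θ least (λ _ → inj₂ (least-≤ _))
  ... | k , e = ⊑-antisym (subst (face Θ zero ⊑_) e (increasing-mono (increasing Θ) z≤n)) (least-≤ _)

  flag-top : ∀ (Θ : Flag n) → face Θ top ≡ greatest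
  flag-top Θ with comparable-in-flag Θ greatest (λ _ → inj₁ (≤-greatest _))
  ... | k , e = ⊑-antisym (≤-greatest _)
    (subst (_⊑ face Θ top) e (increasing-mono (increasing Θ) (FP.≤fromℕ k)))

  bottom-agree : ∀ (A B : Flag n) j → toℕ j ≤ 0 → face A j ≡ face B j
  bottom-agree A B j j≤0 with FP.toℕ-injective {j = zero} (NP.n≤0⇒n≡0 j≤0)
  ... | refl = trans (flag-bottom A) (sym (flag-bottom B))

  top-agree : ∀ (A B : Flag n) j → toℕ top ≤ toℕ j → face A j ≡ face B j
  top-agree A B j top≤j with FP.toℕ-injective (NP.≤-antisym (FP.≤fromℕ j) top≤j)
  ... | refl = trans (flag-top A) (sym (flag-top B))

  minimum : ∀ m (e : Fin (suc m) → Face) → (∀ k l → Comparable (e k) (e l)) →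
    Σ (Fin (suc m)) λ i → ∀ k → e i ⊑ e k
  minimum zero e cmp = zero , λ { zero → ⊑-refl }
  minimum (suc m) e cmp with minimum m (λ k → e (suc k)) (λ k l → cmp (suc k) (suc l))
  ... | i , e[1+i]-min with cmp zero (suc i)
  ...   | inj₁ e0⊑ = zero , λ { zero → ⊑-refl ; (suc k) → ⊑-trans e0⊑ (e[1+i]-min k) }
  ...   | inj₂ ⊑e0 = suc i , λ { zero → ⊑e0 ; (suc k) → e[1+i]-min k }

  sort : ∀ m (e : Fin m → Face) → (∀ k l → e k ≡ e l → k ≡ l) → (∀ k l → Comparable (e k) (e l)) →
    Σ (Fin m → Face) λ f → Increasing f × (∀ k → ∃ λ l → f l ≡ e k) × (∀ l → ∃ λ k → e k ≡ f l)
  sort zero e _ _ = e , (λ ()) , (λ ()) , (λ ())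
  sort (suc m) e inj cmp = f , inc , covers , within
    where
    i = proj₁ (minimum m e cmp)
    rest = sort m (λ k → e (punchIn i k)) (λ k l eq → FP.punchIn-injective i k l (inj _ _ eq)) (λ k l → cmp _ _)
    f′ = proj₁ rest
    within′ = proj₂ (proj₂ (proj₂ rest))
    f : Fin (suc m) → Face
    f zero = e i
    f (suc l) = f′ l
    inc : Increasing f
    inc zero (suc l) _ =
      subst (e i ⊑_) (proj₂ (within′ l)) (proj₂ (minimum m e cmp) (punchIn i (proj₁ (within′ l)))) ,
      λ eq → FP.punchInᵢ≢i i (proj₁ (within′ l)) (sym (inj _ _ (trans eq (sym (proj₂ (within′ l))))))
    inc (suc k) (suc l) k<l = proj₁ (proj₂ rest) k l (s<s⁻¹ k<l)
    covers : ∀ k → ∃ λ l → f l ≡ e k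
    covers k with i ≟ k
    ... | yes refl = zero , refl
    ... | no i≢k = suc (proj₁ covered) , trans (proj₂ covered) (cong e (FP.punchIn-punchOut i≢k))
      where covered = proj₁ (proj₂ (proj₂ rest)) (punchOut i≢k)
    within : ∀ l → ∃ λ k → e k ≡ f l
    within zero = i , refl
    within (suc l) = punchIn i (proj₁ (within′ l)) , proj₂ (within′ l)

  chain-in-flag : ∀ C → IsChain C → Σ (Flag n) λ Λ → ∀ x → C x → ∃ λ l → face Λ l ≡ x
  chain-in-flag C chainC = flagOf f (proj₁ (proj₂ sorted)) , λ x x∈C →
      let (k , ek≡x) = Equivalence.to (enum-onto x) (C⊆M x x∈C)
          (l , fl≡ek) = proj₁ (proj₂ (proj₂ sorted)) k
      in l , trans fl≡ek ek≡x
    where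
    M = chains-in-flags C chainC
    chainM = proj₁ (proj₁ (proj₂ M))
    C⊆M = proj₁ (proj₂ (proj₂ M))
    enum = proj₁ (proj₂ (proj₂ (proj₂ M)))
    enum-inj = proj₁ (proj₂ (proj₂ (proj₂ (proj₂ M))))
    enum-onto = proj₂ (proj₂ (proj₂ (proj₂ (proj₂ M))))
    in-M : ∀ k → proj₁ M (enum k)
    in-M k = Equivalence.from (enum-onto (enum k)) (k , refl)
    sorted = sort _ enum enum-inj (λ k l → chainM _ _ (in-M k) (in-M l))
    f = proj₁ sorted

  face-in-flag : ∀ F → Σ (Flag n) λ Λ → ∃ λ l → face Λ l ≡ F
  face-in-flag F = proj₁ through , proj₂ through F refl
    where through = chain-in-flag (λ x → x ≡ F) (λ { _ _ refl refl → inj₁ ⊑-refl })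

  position-≥ : (Λ : Flag n) (A : Pos → Face) → Increasing A → (p : Pos) →
    (∀ j → toℕ j ≤ toℕ p → ∃ λ l → face Λ l ≡ A j) →
    ∀ j → toℕ j ≤ toℕ p → ∀ l → face Λ l ≡ A j → toℕ j ≤ toℕ l
  position-≥ Λ A incA p onΛ = FI.<-weakInduction P (λ _ _ _ → z≤n) next
    where
    P : Pos → Set
    P j = toℕ j ≤ toℕ p → ∀ l → face Λ l ≡ A j → toℕ j ≤ toℕ l
    next : ∀ i → P (inject₁ i) → P (suc i)
    next i ih i+1≤p l Λl≡A =
      NP.≤-<-trans (subst (_≤ toℕ l′) (FP.toℕ-inject₁ i) (ih i≤p l′ Λl′≡A))
                   (index-< (increasing Λ) (subst₂ _⊏_ (sym Λl′≡A) (sym Λl≡A) (incA _ _ i<i+1)))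
      where
      i<i+1 : toℕ (inject₁ i) <ℕ suc (toℕ i)
      i<i+1 = s≤s (NP.≤-reflexive (FP.toℕ-inject₁ i))
      i≤p : toℕ (inject₁ i) ≤ toℕ p
      i≤p = NP.<⇒≤ (NP.<-≤-trans i<i+1 i+1≤p)
      l′ = proj₁ (onΛ (inject₁ i) i≤p)
      Λl′≡A = proj₂ (onΛ (inject₁ i) i≤p)

  position-≤ : (Λ : Flag n) (B : Pos → Face) → Increasing B → (q : Pos) →
    (∀ j → toℕ q ≤ toℕ j → ∃ λ l → face Λ l ≡ B j) →
    ∀ j → toℕ q ≤ toℕ j → ∀ l → face Λ l ≡ B j → toℕ l ≤ toℕ j
  position-≤ Λ B incB q onΛ = FI.>-weakInduction P (λ _ l _ → FP.≤fromℕ l) previous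
    where
    P : Pos → Set
    P j = toℕ q ≤ toℕ j → ∀ l → face Λ l ≡ B j → toℕ l ≤ toℕ j
    previous : ∀ i → P (suc i) → P (inject₁ i)
    previous i ih q≤i l Λl≡B =
      subst (toℕ l ≤_) (sym (FP.toℕ-inject₁ i))
        (s≤s⁻¹ (NP.<-≤-trans
          (index-< (increasing Λ) (subst₂ _⊏_ (sym Λl≡B) (sym Λl′≡B) (incB _ _ i<i+1)))
          (ih q≤i+1 l′ Λl′≡B)))
      where
      i<i+1 : toℕ (inject₁ i) <ℕ suc (toℕ i)
      i<i+1 = s≤s (NP.≤-reflexive (FP.toℕ-inject₁ i))
      q≤i+1 : toℕ q ≤ suc (toℕ i)
      q≤i+1 = NP.<⇒≤ (NP.≤-<-trans q≤i i<i+1)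
      l′ = proj₁ (onΛ (suc i) q≤i+1)
      Λl′≡B = proj₂ (onΛ (suc i) q≤i+1)

  Splice : Flag n → Flag n → Pos → Pos → Face → Set
  Splice A B p q x = (∃ λ j → toℕ j ≤ toℕ p × face A j ≡ x)
                   ⊎ (∃ λ j → toℕ q ≤ toℕ j × face B j ≡ x)

  splice-chain : ∀ (A B : Flag n) p q → face A p ⊑ face B q → IsChain (Splice A B p q)
  splice-chain A B p q Ap⊑Bq = chain
    where
    across : ∀ {i j} → toℕ i ≤ toℕ p → toℕ q ≤ toℕ j → face A i ⊑ face B j
    across i≤p q≤j = ⊑-trans (increasing-mono (increasing A) i≤p)
                             (⊑-trans Ap⊑Bq (increasing-mono (increasing B) q≤j))
    chain : IsChain (Splice A B p q)
    chain _ _ (inj₁ (i , _ , refl)) (inj₁ (j , _ , refl)) = increasing-comparable (increasing A) i j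
    chain _ _ (inj₂ (i , _ , refl)) (inj₂ (j , _ , refl)) = increasing-comparable (increasing B) i j
    chain _ _ (inj₁ (i , i≤p , refl)) (inj₂ (j , q≤j , refl)) = inj₁ (across i≤p q≤j)
    chain _ _ (inj₂ (j , q≤j , refl)) (inj₁ (i , i≤p , refl)) = inj₂ (across i≤p q≤j)

  -- Ranks are monotone: if A_p ≤ B_q for flags A, B then p ≤ q.  In a flag
  -- through the splice, A_p sits at a position ≥ p and B_q at one ≤ q.
  rank-mono : ∀ (A B : Flag n) p q → face A p ⊑ face B q → toℕ p ≤ toℕ q
  rank-mono A B p q Ap⊑Bq =
    NP.≤-trans (position-≥ Λ (face A) (increasing A) p onΛ-A p NP.≤-refl σ Λσ≡Ap)
      (NP.≤-trans (index-≤ (increasing Λ) (subst₂ _⊑_ (sym Λσ≡Ap) (sym Λτ≡Bq) Ap⊑Bq))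
                  (position-≤ Λ (face B) (increasing B) q onΛ-B q NP.≤-refl τ Λτ≡Bq))
    where
    through = chain-in-flag (Splice A B p q) (splice-chain A B p q Ap⊑Bq)
    Λ = proj₁ through
    onΛ-A : ∀ j → toℕ j ≤ toℕ p → ∃ λ l → face Λ l ≡ face A j
    onΛ-A j j≤p = proj₂ through (face A j) (inj₁ (j , j≤p , refl))
    onΛ-B : ∀ j → toℕ q ≤ toℕ j → ∃ λ l → face Λ l ≡ face B j
    onΛ-B j q≤j = proj₂ through (face B j) (inj₂ (j , q≤j , refl))
    σ = proj₁ (onΛ-A p NP.≤-refl)
    Λσ≡Ap = proj₂ (onΛ-A p NP.≤-refl)
    τ = proj₁ (onΛ-B q NP.≤-refl)
    Λτ≡Bq = proj₂ (onΛ-B q NP.≤-refl)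

  rank-unique : ∀ (A B : Flag n) p q → face A p ≡ face B q → p ≡ q
  rank-unique A B p q Ap≡Bq = FP.toℕ-injective (NP.≤-antisym
    (rank-mono A B p q (⊑-reflexive Ap≡Bq)) (rank-mono B A q p (⊑-reflexive (sym Ap≡Bq))))

  same-position : ∀ (Λ A : Flag n) j → (∃ λ l → face Λ l ≡ face A j) → face Λ j ≡ face A j
  same-position Λ A j (l , Λl≡Aj) with rank-unique Λ A l j Λl≡Aj
  ... | refl = Λl≡Aj

  splice-flag : ∀ (A B : Flag n) p q → face A p ⊑ face B q → Σ (Flag n) λ Λ →
    (∀ j → toℕ j ≤ toℕ p → face Λ j ≡ face A j) × (∀ j → toℕ q ≤ toℕ j → face Λ j ≡ face B j)
  splice-flag A B p q Ap⊑Bq =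
    Λ , (λ j j≤p → same-position Λ A j (proj₂ through (face A j) (inj₁ (j , j≤p , refl))))
      , (λ j q≤j → same-position Λ B j (proj₂ through (face B j) (inj₂ (j , q≤j , refl))))
    where
    through = chain-in-flag (Splice A B p q) (splice-chain A B p q Ap⊑Bq)
    Λ = proj₁ through

  data Path (L : Pos → Set) (A : Flag n) : Flag n → Set₁ where
    done : ∀ {B} → face A ≗ face B → Path L A B
    step : ∀ {B C} → Path L A B → (k : Pos) → L k → (∀ j → j ≢ k → face B j ≡ face C j) → Path L A C

  path-≗ : ∀ {L A B C} → Path L A B → face B ≗ face C → Path L A C
  path-≗ (done A≗B) B≗C = done (λ j → trans (A≗B j) (B≗C j))
  path-≗ (step path k k∈L B≗C′) C′≗C = step path k k∈L (λ j j≢k → trans (B≗C′ j j≢k) (C′≗C j))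

  _++ₚ_ : ∀ {L A B C} → Path L A B → Path L B C → Path L A C
  path ++ₚ done B≗C = path-≗ path B≗C
  path ++ₚ step path′ k k∈L e = step (path ++ₚ path′) k k∈L e

  path-map : ∀ {L L′ : Pos → Set} {A B} → (∀ {k} → L k → L′ k) → Path L A B → Path L′ A B
  path-map f (done e) = done e
  path-map f (step path k k∈L e) = step (path-map f path) k (f k∈L) e

  AgreeOut : Pos → Pos → Flag n → Flag n → Set
  AgreeOut a b A B = ∀ j → (toℕ j ≤ toℕ a ⊎ toℕ b ≤ toℕ j) → face A j ≡ face B j

  Between : Pos → Pos → Pos → Set
  Between a b k = toℕ a <ℕ toℕ k × toℕ k <ℕ toℕ b

  glue : Pos → (Pos → Face) → (Pos → Face) → Pos → Face
  glue c A B j with toℕ j ≤? toℕ c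
  ... | yes _ = A j
  ... | no _ = B j

  glue-below : ∀ c A B j → toℕ j ≤ toℕ c → glue c A B j ≡ A j
  glue-below c A B j j≤c with toℕ j ≤? toℕ c
  ... | yes _ = refl
  ... | no j≰c = ⊥-elim (j≰c j≤c)

  glue-above : ∀ c A B j → ¬ (toℕ j ≤ toℕ c) → glue c A B j ≡ B j
  glue-above c A B j j≰c with toℕ j ≤? toℕ c
  ... | yes j≤c = ⊥-elim (j≰c j≤c)
  ... | no _ = refl

  glue-increasing : ∀ c {A B : Pos → Face} → Increasing A → Increasing B → A c ≡ B c →
    Increasing (glue c A B)
  glue-increasing c {A} {B} incA incB Ac≡Bc k l k<l = cases (toℕ k ≤? toℕ c) (toℕ l ≤? toℕ c)
    where
    cases : Dec (toℕ k ≤ toℕ c) → Dec (toℕ l ≤ toℕ c) → glue c A B k ⊏ glue c A B l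
    cases (yes k≤c) (yes l≤c) =
      subst₂ _⊏_ (sym (glue-below c A B k k≤c)) (sym (glue-below c A B l l≤c)) (incA k l k<l)
    cases (yes k≤c) (no l≰c) = subst₂ _⊏_ (sym (glue-below c A B k k≤c)) (sym (glue-above c A B l l≰c))
      (⊑-⊏-trans (subst (A k ⊑_) Ac≡Bc (increasing-mono incA k≤c)) (incB c l (NP.≰⇒> l≰c)))
    cases (no k≰c) (yes l≤c) = ⊥-elim (k≰c (NP.≤-trans (NP.<⇒≤ k<l) l≤c))
    cases (no k≰c) (no l≰c) =
      subst₂ _⊏_ (sym (glue-above c A B k k≰c)) (sym (glue-above c A B l l≰c)) (incB k l k<l)

  hybrid : ∀ c (A B : Flag n) → face A c ≡ face B c → Flag n
  hybrid c A B Ac≡Bc = flagOf (glue c (face A) (face B)) (glue-increasing c (increasing A) (increasing B) Ac≡Bc)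

  hybrid-below : ∀ c A B Ac≡Bc j → toℕ j ≤ toℕ c → face (hybrid c A B Ac≡Bc) j ≡ face A j
  hybrid-below c A B _ j = glue-below c (face A) (face B) j

  hybrid-above : ∀ c A B Ac≡Bc j → toℕ c ≤ toℕ j → face (hybrid c A B Ac≡Bc) j ≡ face B j
  hybrid-above c A B Ac≡Bc j c≤j = by-cases (toℕ j ≤? toℕ c)
    where
    by-cases : Dec (toℕ j ≤ toℕ c) → glue c (face A) (face B) j ≡ face B j
    by-cases (no j≰c) = glue-above c (face A) (face B) j j≰c
    by-cases (yes j≤c) = trans (glue-below c (face A) (face B) j j≤c)
      (subst (λ x → face A x ≡ face B x) (sym (FP.toℕ-injective (NP.≤-antisym j≤c c≤j))) Ac≡Bc)

  successor : (a b : Pos) → toℕ a <ℕ toℕ b → Σ Pos λ a′ → toℕ a′ ≡ suc (toℕ a)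
  successor a b a<b = fromℕ< a+1<n+2 , FP.toℕ-fromℕ< a+1<n+2
    where
    a+1<n+2 : suc (toℕ a) <ℕ suc (suc n)
    a+1<n+2 = NP.≤-<-trans a<b (FP.toℕ<n b)

  ConnectedWithin : ℕ → Set₁
  ConnectedWithin d = ∀ (a b : Pos) → toℕ b ≤ toℕ a + d →
    ∀ A B → AgreeOut a b A B → Path (Between a b) A B

  -- Flags agreeing outside (a, b) and at some c inside: join both halves
  -- through the hybrid flag, each half being a shorter interval.
  split : ∀ d → ConnectedWithin d → ∀ (a b c : Pos) → toℕ b ≤ toℕ a + suc d → Between a b c →
    ∀ A B → AgreeOut a b A B → face A c ≡ face B c → Path (Between a b) A B
  split d connected-d a b c b≤a+d+1 (a<c , c<b) A B agree Ac≡Bc =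
      path-map (λ (a<k , k<c) → a<k , NP.<-trans k<c c<b) (connected-d a c c≤a+d A Θ lower)
   ++ₚ path-map (λ (c<k , k<b) → NP.<-trans a<c c<k , k<b) (connected-d c b b≤c+d Θ B upper)
    where
    Θ = hybrid c B A (sym Ac≡Bc)
    b≤1+a+d : toℕ b ≤ suc (toℕ a + d)
    b≤1+a+d = subst (toℕ b ≤_) (NP.+-suc (toℕ a) d) b≤a+d+1
    c≤a+d : toℕ c ≤ toℕ a + d
    c≤a+d = s≤s⁻¹ (NP.≤-trans c<b b≤1+a+d)
    b≤c+d : toℕ b ≤ toℕ c + d
    b≤c+d = NP.≤-trans b≤1+a+d (NP.+-monoˡ-≤ d a<c)
    lower : AgreeOut a c A Θ
    lower j (inj₁ j≤a) =
      trans (agree j (inj₁ j≤a)) (sym (hybrid-below c B A (sym Ac≡Bc) j (NP.≤-trans j≤a (NP.<⇒≤ a<c))))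
    lower j (inj₂ c≤j) = sym (hybrid-above c B A (sym Ac≡Bc) j c≤j)
    upper : AgreeOut c b Θ B
    upper j (inj₁ j≤c) = hybrid-below c B A (sym Ac≡Bc) j j≤c
    upper j (inj₂ b≤j) =
      trans (hybrid-above c B A (sym Ac≡Bc) j (NP.≤-trans (NP.<⇒≤ c<b) b≤j)) (agree j (inj₂ b≤j))

  PassesBetween : Pos → Pos → Flag n → Face → Set
  PassesBetween a b Λ X = Σ Pos λ l → Between a b l × face Λ l ≡ X

  flag-through : ∀ (A : Flag n) a b {X Y} → Proper (face A a) (face A b) X → Proper (face A a) (face A b) Y →
    Comparable X Y → Σ (Flag n) λ Λ → AgreeOut a b A Λ × PassesBetween a b Λ X × PassesBetween a b Λ Y
  flag-through A a b {X} {Y} properX properY X~Y = Λ , agree , passes X (inj₂ (inj₁ refl)) properX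
                                                            , passes Y (inj₂ (inj₂ refl)) properY
    where
    Outside : Pos → Set
    Outside i = toℕ i ≤ toℕ a ⊎ toℕ b ≤ toℕ i
    C : Face → Set
    C x = (∃ λ i → Outside i × face A i ≡ x) ⊎ (x ≡ X ⊎ x ≡ Y)
    outside-comparable : ∀ {Z} i → Outside i → Proper (face A a) (face A b) Z → Comparable (face A i) Z
    outside-comparable i (inj₁ i≤a) (a⊏Z , _) =
      inj₁ (⊑-trans (increasing-mono (increasing A) i≤a) (proj₁ a⊏Z))
    outside-comparable i (inj₂ b≤i) (_ , Z⊏b) =
      inj₂ (⊑-trans (proj₁ Z⊏b) (increasing-mono (increasing A) b≤i))
    chain : IsChain C
    chain _ _ (inj₁ (i , _ , refl)) (inj₁ (j , _ , refl)) = increasing-comparable (increasing A) i j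
    chain _ _ (inj₁ (i , o , refl)) (inj₂ (inj₁ refl)) = outside-comparable i o properX
    chain _ _ (inj₁ (i , o , refl)) (inj₂ (inj₂ refl)) = outside-comparable i o properY
    chain _ _ (inj₂ (inj₁ refl)) (inj₁ (i , o , refl)) = swap (outside-comparable i o properX)
    chain _ _ (inj₂ (inj₂ refl)) (inj₁ (i , o , refl)) = swap (outside-comparable i o properY)
    chain _ _ (inj₂ (inj₁ refl)) (inj₂ (inj₁ refl)) = inj₁ ⊑-refl
    chain _ _ (inj₂ (inj₁ refl)) (inj₂ (inj₂ refl)) = X~Y
    chain _ _ (inj₂ (inj₂ refl)) (inj₂ (inj₁ refl)) = swap X~Y
    chain _ _ (inj₂ (inj₂ refl)) (inj₂ (inj₂ refl)) = inj₁ ⊑-refl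
    through = chain-in-flag C chain
    Λ = proj₁ through
    agree : AgreeOut a b A Λ
    agree i o = sym (same-position Λ A i (proj₂ through (face A i) (inj₁ (i , o , refl))))
    passes : ∀ Z → C Z → Proper (face A a) (face A b) Z → PassesBetween a b Λ Z
    passes Z Z∈C (a⊏Z , Z⊏b) =
      l , (index-< (increasing Λ) (subst₂ _⊏_ (agree a (inj₁ NP.≤-refl)) (sym Λl≡Z) a⊏Z)
         , index-< (increasing Λ) (subst₂ _⊏_ (sym Λl≡Z) (agree b (inj₂ NP.≤-refl)) Z⊏b)) , Λl≡Z
      where
      l = proj₁ (proj₂ through Z Z∈C)
      Λl≡Z = proj₂ (proj₂ through Z Z∈C)

  -- Intervals of length ≥ 3: (I3) joins A_{a+1} and B_{a+1} by proper faces of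
  -- the section A_b / A_a, consecutive ones comparable.  Walking along this
  -- sequence, each face X is put on a flag Θ agreeing with A outside (a, b);
  -- consecutive such flags share a face inside (a, b), so split applies.
  connect-via-section : ∀ d → ConnectedWithin d → ∀ (a b : Pos) → toℕ b ≤ toℕ a + suc d →
    suc (suc (suc (toℕ a))) ≤ toℕ b → ∀ A B → AgreeOut a b A B → Path (Between a b) A B
  connect-via-section d connected-d a b b≤a+d+1 a+3≤b A B agree = walk joined B agree (a₁ , a₁∈ , refl)
    where
    a+1<b : suc (toℕ a) <ℕ toℕ b
    a+1<b = NP.≤-trans (NP.n≤1+n _) a+3≤b
    next = successor a b (NP.<-trans (NP.n<1+n _) a+1<b)
    a₁ = proj₁ next
    a₁∈ : Between a b a₁
    a₁∈ = subst (toℕ a <ℕ_) (sym (proj₂ next)) (NP.n<1+n _) , subst (_<ℕ toℕ b) (sym (proj₂ next)) a+1<b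
    Fa = face A a
    Fb = face A b
    proper-A : Proper Fa Fb (face A a₁)
    proper-A = increasing A a a₁ (proj₁ a₁∈) , increasing A a₁ b (proj₂ a₁∈)
    proper-B : Proper Fa Fb (face B a₁)
    proper-B = subst (_⊏ face B a₁) (sym (agree a (inj₁ NP.≤-refl))) (increasing B a a₁ (proj₁ a₁∈)) ,
               subst (face B a₁ ⊏_) (sym (agree b (inj₂ NP.≤-refl))) (increasing B a₁ b (proj₂ a₁∈))
    joined : Joined Fa Fb (face A a₁) (face B a₁)
    joined = connected Fa Fb a b (A , refl) (A , refl)
      (increasing-mono (increasing A) (NP.<⇒≤ (NP.<-trans (proj₁ a₁∈) (proj₂ a₁∈))))
      a+3≤b (face A a₁) (face B a₁) proper-A proper-B
    joined-proper : ∀ {Y} → Joined Fa Fb (face A a₁) Y → Proper Fa Fb Y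
    joined-proper here = proper-A
    joined-proper (step _ proper _) = proper
    walk : ∀ {X} → Joined Fa Fb (face A a₁) X → ∀ Θ → AgreeOut a b A Θ → PassesBetween a b Θ X →
      Path (Between a b) A Θ
    walk here Θ agreeΘ (c , _ , Θc≡Aa₁) =
      split d connected-d a b a₁ b≤a+d+1 a₁∈ A Θ agreeΘ (sym (same-position Θ A a₁ (c , Θc≡Aa₁)))
    walk (step earlier properX X′~X) Θ agreeΘ (c , c∈ , Θc≡X) =
      walk earlier Λ agreeΛ passesX′
      ++ₚ split d connected-d a b c b≤a+d+1 c∈ Λ Θ (λ i o → trans (sym (agreeΛ i o)) (agreeΘ i o))
                (same-position Λ Θ c (proj₁ passesX , trans (proj₂ (proj₂ passesX)) (sym Θc≡X)))
      where
      through = flag-through A a b (joined-proper earlier) properX X′~X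
      Λ = proj₁ through
      agreeΛ = proj₁ (proj₂ through)
      passesX′ = proj₁ (proj₂ (proj₂ through))
      passesX = proj₂ (proj₂ (proj₂ through))

  nothing-between : ∀ (a b : Pos) → toℕ b ≤ suc (toℕ a) →
    ∀ (j : Pos) → toℕ j ≤ toℕ a ⊎ toℕ b ≤ toℕ j
  nothing-between a b b≤a+1 j with toℕ j ≤? toℕ a
  ... | yes j≤a = inj₁ j≤a
  ... | no j≰a = inj₂ (NP.≤-trans b≤a+1 (NP.≰⇒> j≰a))

  -- Induction on the length of the interval: lengths ≤ 1 need no step, length 2
  -- one step at a+1, and longer intervals are handled by connect-via-section.
  connect-within : ∀ d → ConnectedWithin d
  connect-within zero a b b≤a+0 A B agree =
    done (λ j → agree j (nothing-between a b b≤a+1 j))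
    where
    b≤a+1 : toℕ b ≤ suc (toℕ a)
    b≤a+1 = NP.m≤n⇒m≤1+n (subst (toℕ b ≤_) (NP.+-identityʳ (toℕ a)) b≤a+0)
  connect-within (suc d) a b b≤a+d+1 A B agree with toℕ b ≤? suc (toℕ a)
  ... | yes b≤a+1 = done (λ j → agree j (nothing-between a b b≤a+1 j))
  ... | no b≰a+1 with toℕ b ≤? suc (suc (toℕ a))
  ...   | no b≰a+2 = connect-via-section d (connect-within d) a b b≤a+d+1 (NP.≰⇒> b≰a+2) A B agree
  ...   | yes b≤a+2 = step {B = A} (done (λ _ → refl)) k k∈ (λ j j≢k → agree j (outside j j≢k))
    where
    a+1<b : suc (toℕ a) <ℕ toℕ b
    a+1<b = NP.≰⇒> b≰a+1
    next = successor a b (NP.<-trans (NP.n<1+n _) a+1<b)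
    k = proj₁ next
    k≡a+1 : toℕ k ≡ suc (toℕ a)
    k≡a+1 = proj₂ next
    k∈ : Between a b k
    k∈ = subst (toℕ a <ℕ_) (sym k≡a+1) (NP.n<1+n _) , subst (_<ℕ toℕ b) (sym k≡a+1) a+1<b
    outside : ∀ j → j ≢ k → toℕ j ≤ toℕ a ⊎ toℕ b ≤ toℕ j
    outside j j≢k with toℕ j ≤? toℕ a
    ... | yes j≤a = inj₁ j≤a
    ... | no j≰a = inj₂ (NP.≤-trans b≤a+2 (NP.≤∧≢⇒< (NP.≰⇒> j≰a)
                    (λ a+1≡j → j≢k (FP.toℕ-injective (trans (sym a+1≡j) (sym k≡a+1))))))

  connect : ∀ a b (A B : Flag n) → AgreeOut a b A B → Path (Between a b) A B
  connect a b = connect-within (suc (suc n)) a b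
    (NP.≤-trans (FP.toℕ≤pred[n] b) (NP.≤-trans (NP.n≤1+n _) (NP.m≤n+m _ (toℕ a))))

  connect-above : ∀ p (A B : Flag n) → (∀ j → toℕ j ≤ toℕ p → face A j ≡ face B j) →
    Path (λ k → suc (toℕ p) ≤ toℕ k) A B
  connect-above p A B agree = path-map proj₁ (connect p top A B outside)
    where
    outside : AgreeOut p top A B
    outside j (inj₁ j≤p) = agree j j≤p
    outside j (inj₂ top≤j) = top-agree A B j top≤j

  connect-below : ∀ q (A B : Flag n) → (∀ j → toℕ q ≤ toℕ j → face A j ≡ face B j) →
    Path (λ k → toℕ k <ℕ toℕ q) A B
  connect-below q A B agree = path-map proj₂ (connect zero q A B outside)
    where
    outside : AgreeOut zero q A B
    outside j (inj₁ j≤0) = bottom-agree A B j j≤0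
    outside j (inj₂ q≤j) = agree j q≤j

  connect-avoiding : ∀ p (A B : Flag n) → face A p ≡ face B p → Path (λ k → k ≢ p) A B
  connect-avoiding p A B Ap≡Bp =
       path-map (λ (_ , k<p) k≡p → NP.<⇒≢ k<p (cong toℕ k≡p)) (connect zero p A Θ lower)
    ++ₚ path-map (λ (p<k , _) k≡p → NP.<⇒≢ p<k (cong toℕ (sym k≡p))) (connect p top Θ B upper)
    where
    Θ = hybrid p B A (sym Ap≡Bp)
    lower : AgreeOut zero p A Θ
    lower j (inj₁ j≤0) = bottom-agree A Θ j j≤0
    lower j (inj₂ p≤j) = sym (hybrid-above p B A (sym Ap≡Bp) j p≤j)
    upper : AgreeOut p top Θ B
    upper j (inj₁ j≤p) = hybrid-below p B A (sym Ap≡Bp) j j≤p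
    upper j (inj₂ top≤j) = top-agree Θ B j top≤j

module CosetIsomorphism (n : ℕ) (K : IncidenceComplex n) (S : IncidenceComplex.Aut K → Set)
  (subgroup : IncidenceComplex.IsSubgroup K S) (transitive : IncidenceComplex.FlagTransitive K n S)
  (Φ : IncidenceComplex.Flag K n) where
  open IncidenceComplex K renaming (_≤_ to _⊑_; _<_ to _⊏_)
  open FlagGeometry n K hiding (Pos)
  open CosetComplex K S Φ
  module Γ = IsSubgroup subgroup

  Fixes : Aut → Pos → Set
  Fixes φ j = fun φ (face Φ j) ≡ face Φ j

  Generators : (Pos → Set) → Aut → Set
  Generators I φ = ∃ λ k → I k × R k φ

  -- If χ ∈ Γ maps Φ to a flag Ψ reached from Φ by an I-path, then χ is a product
  -- of generators of Γ_I: each step Ψ′ → Ψ″ at position k contributes χ″χ′⁻¹ ∈ R_k,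
  -- where χ′, χ″ ∈ Γ map Φ to Ψ′, Ψ″ (flag-transitivity).
  path-generated : ∀ {I Ψ} → Path I Φ Ψ → ∀ χ → S χ → (∀ j → fun χ (face Φ j) ≡ face Ψ j) →
    ∀ k₀ → I k₀ → Gen (Generators I) χ
  path-generated (done Φ≗Ψ) χ χ∈Γ maps k₀ k₀∈I =
    base (k₀ , k₀∈I , χ∈Γ , λ j _ → trans (maps j) (sym (Φ≗Ψ j)))
  path-generated (step {B = Ψ′} path k k∈I Ψ′≗Ψ) χ χ∈Γ maps k₀ k₀∈I =
      resp (λ F → fun-inv χ′ (fun χ F)) (mul (base (k , k∈I , Γ.mul χ∈Γ (Γ.inverse χ′∈Γ) , in-Rk))
                                             (path-generated path χ′ χ′∈Γ maps′ k₀ k₀∈I))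
    where
    χ′ = proj₁ (transitive Φ Ψ′)
    χ′∈Γ = proj₁ (proj₂ (transitive Φ Ψ′))
    maps′ = proj₂ (proj₂ (transitive Φ Ψ′))
    in-Rk : ∀ j → j ≢ k → Fixes (χ · (χ′ ⁻¹)) j
    in-Rk j j≢k = inv-shift-≡ χ′ (trans (maps j) (sym (trans (maps′ j) (Ψ′≗Ψ j j≢k))))

  Γ_I-intro : ∀ (I : Pos → Set) (decI : Dec (∃ I)) φ → S φ → (∀ k → ¬ I k → Fixes φ k) →
    Path I Φ (mapFlag φ Φ) → ΓI′ I decI φ
  Γ_I-intro I (yes (k₀ , k₀∈I)) φ φ∈Γ _ path = path-generated path φ φ∈Γ (λ _ → refl) k₀ k₀∈I
  Γ_I-intro I (no I-empty) φ φ∈Γ fixes _ = φ∈Γ , λ j _ → fixes j (λ j∈I → I-empty (j , j∈I))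

  generated-fixes : ∀ {I} p → (∀ k → I k → k ≢ p) → ∀ {φ} → Gen (Generators I) φ → Fixes φ p
  generated-fixes p p∉I (base (k , k∈I , _ , fixes)) = fixes p (λ p≡k → p∉I k k∈I (sym p≡k))
  generated-fixes p p∉I one = refl
  generated-fixes p p∉I (mul {ψ = ψ} g h) =
    trans (cong (fun ψ) (generated-fixes p p∉I g)) (generated-fixes p p∉I h)
  generated-fixes p p∉I (inverse {φ} g) = inv-shift-≡ φ (sym (generated-fixes p p∉I g))
  generated-fixes p p∉I (resp φ≐ψ g) = trans (sym (φ≐ψ _)) (generated-fixes p p∉I g)

  -- The same for Γ_I itself; for I = ∅ the elements of R₋₁ fix F_{-1} = least too.
  Γ_I-fixes : ∀ I decI φ p → (∀ k → I k → k ≢ p) → ΓI′ I decI φ → Fixes φ p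
  Γ_I-fixes I (yes _) φ p p∉I g = generated-fixes p p∉I g
  Γ_I-fixes I (no _) φ p p∉I (_ , fixes) with p ≟ zero
  ... | yes refl = trans (flag-bottom (mapFlag φ Φ)) (sym (flag-bottom Φ))
  ... | no p≢0 = fixes p p≢0

  Γexcept-intro : ∀ φ p → S φ → Fixes φ p → Γexcept p φ
  Γexcept-intro φ p φ∈Γ fixes =
    Γ_I-intro (λ k → k ≢ p) (any? (λ k → ¬? (k ≟ p))) φ φ∈Γ fixes-off
      (connect-avoiding p Φ (mapFlag φ Φ) (sym fixes))
    where
    fixes-off : ∀ k → ¬ (k ≢ p) → Fixes φ k
    fixes-off k k≢p↯ with k ≟ p
    ... | yes refl = fixes
    ... | no k≢p = ⊥-elim (k≢p↯ k≢p)

  Γexcept-fixes : ∀ {φ} p → Γexcept p φ → Fixes φ p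
  Γexcept-fixes {φ} p =
    Γ_I-fixes (λ k → k ≢ p) (any? (λ k → ¬? (k ≟ p))) φ p (λ _ k≢p → k≢p)

  Γplus-intro : ∀ φ p → S φ → (∀ j → toℕ j ≤ toℕ p → Fixes φ j) → Γplus (suc (toℕ p)) φ
  Γplus-intro φ p φ∈Γ fixes =
    Γ_I-intro (λ k → suc (toℕ p) ≤ toℕ k) (any? (λ k → suc (toℕ p) ≤? toℕ k)) φ φ∈Γ
      (λ k p<k↯ → fixes k (NP.m<1+n⇒m≤n (NP.≰⇒> p<k↯)))
      (connect-above p Φ (mapFlag φ Φ) (λ j j≤p → sym (fixes j j≤p)))

  Γplus-fixes : ∀ {φ} p → Γplus (suc (toℕ p)) φ → Fixes φ p
  Γplus-fixes {φ} p =
    Γ_I-fixes (λ k → suc (toℕ p) ≤ toℕ k) (any? (λ k → suc (toℕ p) ≤? toℕ k)) φ p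
      (λ k p<k k≡p → NP.<-irrefl (cong toℕ (sym k≡p)) p<k)

  Γminus-intro : ∀ φ q → S φ → (∀ j → toℕ q ≤ toℕ j → Fixes φ j) → Γminus (toℕ q) φ
  Γminus-intro φ q φ∈Γ fixes =
    Γ_I-intro (λ k → toℕ k <ℕ toℕ q) (any? (λ k → suc (toℕ k) ≤? toℕ q)) φ φ∈Γ
      (λ k k≮q → fixes k (NP.≮⇒≥ k≮q))
      (connect-below q Φ (mapFlag φ Φ) (λ j q≤j → sym (fixes j q≤j)))

  Γminus-fixes : ∀ {φ} q → Γminus (toℕ q) φ → Fixes φ q
  Γminus-fixes {φ} q =
    Γ_I-fixes (λ k → toℕ k <ℕ toℕ q) (any? (λ k → suc (toℕ k) ≤? toℕ q)) φ q
      (λ k k<q k≡q → NP.<-irrefl (cong toℕ k≡q) k<q)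

  -- If θ ∈ Γ maps F_p below F_q, then θ = αχ with α fixing F_0, …, F_p and
  -- χ fixing F_q, …, F_{n+1}: take χ mapping Φ to a flag that agrees with Φθ up
  -- to p and with Φ from q on.
  factorise : ∀ θ p q → S θ → fun θ (face Φ p) ⊑ face Φ q →
    Σ Aut λ α → Σ Aut λ χ → Γplus (suc (toℕ p)) α × Γminus (toℕ q) χ × θ ≐ (α · χ)
  factorise θ p q θ∈Γ θFp⊑Fq = θ · (χ ⁻¹) , χ ,
      Γplus-intro (θ · (χ ⁻¹)) p (Γ.mul θ∈Γ (Γ.inverse χ∈Γ))
        (λ j j≤p → inv-shift-≡ χ (sym (trans (χ-maps j) (lower j j≤p)))) ,
      Γminus-intro χ q χ∈Γ (λ j q≤j → trans (χ-maps j) (upper j q≤j)) ,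
      λ F → sym (fun-inv χ (fun θ F))
    where
    spliced = splice-flag (mapFlag θ Φ) Φ p q θFp⊑Fq
    Λ = proj₁ spliced
    lower = proj₁ (proj₂ spliced)
    upper = proj₂ (proj₂ spliced)
    χ = proj₁ (transitive Φ Λ)
    χ∈Γ = proj₁ (proj₂ (transitive Φ Λ))
    χ-maps = proj₂ (proj₂ (transitive Φ Λ))

  -- The five properties of the assignment F_p φ ↦ Γ_p φ.
  -- Well defined: F_p φ = F_q ψ forces p = q, and then φψ⁻¹ fixes F_p.
  well-defined : ∀ {F c d} → F ↦ c → F ↦ d → c ≈c d
  well-defined {c = p , φ , φ∈Γ} {q , ψ , ψ∈Γ} φFp≡F ψFq≡F
    with rank-unique (mapFlag φ Φ) (mapFlag ψ Φ) p q (trans φFp≡F (sym ψFq≡F))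
  ... | refl = refl , inj₂ (Γexcept-intro (φ · (ψ ⁻¹)) p (Γ.mul φ∈Γ (Γ.inverse ψ∈Γ))
                                          (inv-shift-≡ ψ (trans φFp≡F (sym ψFq≡F))))

  -- Total: F lies on a flag, which is Φφ for some φ ∈ Γ.
  total : ∀ F → Σ CFace λ c → F ↦ c
  total F = (l , φ , φ∈Γ) , trans (φ-maps l) Λl≡F
    where
    on-flag = face-in-flag F
    l = proj₁ (proj₂ on-flag)
    Λl≡F = proj₂ (proj₂ on-flag)
    φ = proj₁ (transitive Φ (proj₁ on-flag))
    φ∈Γ = proj₁ (proj₂ (transitive Φ (proj₁ on-flag)))
    φ-maps = proj₂ (proj₂ (transitive Φ (proj₁ on-flag)))

  -- Injective: Γ_p φ = Γ_p ψ says p is improper (and F_p is least or greatest)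
  -- or φψ⁻¹ ∈ Γ_p fixes F_p; either way F_p φ = F_p ψ.
  injective : ∀ {F G c d} → F ↦ c → G ↦ d → c ≈c d → F ≡ G
  injective {c = p , φ , _} {.p , ψ , _} φFp≡F ψFp≡G (refl , same) =
    trans (sym φFp≡F) (trans (images same) ψFp≡G)
    where
    images : Improper p ⊎ Γexcept p (φ · (ψ ⁻¹)) → fun φ (face Φ p) ≡ fun ψ (face Φ p)
    images (inj₁ (inj₁ p≡0)) = bottom-agree (mapFlag φ Φ) (mapFlag ψ Φ) p (NP.≤-reflexive p≡0)
    images (inj₁ (inj₂ p≡top)) =
      top-agree (mapFlag φ Φ) (mapFlag ψ Φ) p (NP.≤-reflexive (trans (FP.toℕ-fromℕ (suc n)) (sym p≡top)))
    images (inj₂ φψ⁻¹∈Γp) = inv-unshift-≡ ψ (Γexcept-fixes p φψ⁻¹∈Γp)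

  surjective : ∀ c → Σ Face λ F → F ↦ c
  surjective (p , φ , _) = fun φ (face Φ p) , refl

  -- Order: F_p φ ⊑ F_q ψ iff F_p θ ⊑ F_q for θ = φψ⁻¹, which holds iff
  -- p ≤ q and θ factors through the stabilisers Γ^+ above p and Γ^- below q.
  order : ∀ {F G c d} → F ↦ c → G ↦ d → (F ⊑ G ⇔ c ≤c d)
  order {F} {G} {p , φ , φ∈Γ} {q , ψ , ψ∈Γ} φFp≡F ψFq≡G = mk⇔ to from
    where
    to : F ⊑ G → (p , φ , φ∈Γ) ≤c (q , ψ , ψ∈Γ)
    to F⊑G = rank-mono (mapFlag φ Φ) (mapFlag ψ Φ) p q images ,
             factorise (φ · (ψ ⁻¹)) p q (Γ.mul φ∈Γ (Γ.inverse ψ∈Γ)) (inv-shift-⊑ ψ images)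
      where
      images : fun φ (face Φ p) ⊑ fun ψ (face Φ q)
      images = subst₂ _⊑_ (sym φFp≡F) (sym ψFq≡G) F⊑G
    -- θ = αβ maps F_p to F_p β ⊑ F_q β = F_q.
    from : (p , φ , φ∈Γ) ≤c (q , ψ , ψ∈Γ) → F ⊑ G
    from (p≤q , α , β , α∈Γ⁺ , β∈Γ⁻ , θ≐αβ) = subst₂ _⊑_ φFp≡F ψFq≡G (inv-unshift-⊑ ψ θFp⊑Fq)
      where
      θFp⊑Fq : fun (φ · (ψ ⁻¹)) (face Φ p) ⊑ face Φ q
      θFp⊑Fq = subst₂ _⊑_ (sym (trans (θ≐αβ _) (cong (fun β) (Γplus-fixes p α∈Γ⁺))))
                           (Γminus-fixes q β∈Γ⁻)
                           (fun-mono β (increasing-mono (increasing Φ) p≤q))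

theorem4p4 : (n : ℕ) → 1 ≤ n → (K : IncidenceComplex n) → Regular K →
    (S : IncidenceComplex.Aut K → Set) → IncidenceComplex.IsSubgroup K S →
    IncidenceComplex.FlagTransitive K n S →
    (Φ : IncidenceComplex.Flag K n) →
    CosetComplex.IsWellDefinedIsomorphism K S Φ
theorem4p4 n _ K _ S subgroup transitive Φ = record
  { well-defined = λ {F} {c} {d} → well-defined {F} {c} {d}
  ; total        = total
  ; injective    = λ {F} {G} {c} {d} → injective {F} {G} {c} {d}
  ; surjective   = surjective
  ; order        = λ {F} {G} {c} {d} → order {F} {G} {c} {d}
  }
  where open CosetIsomorphism n K S subgroup transitive Φ
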